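{- Let $n\ge 0$ and $0\le k\le n-1$. Then for every $0\le m\le n$, $$d_{n,m,k}=\frac{1}{k+1}\binom{n-1}{k}\binom{n}{k}.$$
   Context: A Dyck path of semilength $n\ge 0$ is a lattice path in $\mathbb{Z}\times\mathbb{Z}$ from $(0,0)$ to $(2n,0)$ using up steps $U=(1,1)$ and down steps $D=(1,-1)$; it is allowed to go below the $x$-axis. Write it as a word $P_1P_2\cdots P_{2n}$ over $\{U,D\}$. An up step is under the $x$-axis if it goes from height $-h$ to height $-h+1$ for some $h\ge 1$. A Dyck path is $(n,m)$-flawed if it has semilength $n$ and exactly $m$ up steps under the $x$-axis. A double descent is a position $i$ with $P_iP_{i+1}=DD$. Let $d_{n,m,k}$ be the number of $(n,m)$-flawed paths with exactly $k$ double descents. -}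

module Defs where

open import Data.Nat using (ℕ; zero; suc; _+_; _*_; _≟_)
open import Data.Integer as ℤ using (ℤ; +_; -[1+_])
open import Data.List using (List; []; _∷_; length; filter; map; _++_)
open import Data.Product using (_×_)
open import Relation.Binary.PropositionalEquality using (_≡_)

-- Steps of a lattice path: U = (1,1), D = (1,-1).
data Step : Set where
  U D : Step

words : ℕ → List (List Step)
words zero = [] ∷ []
words (suc ℓ) = map (U ∷_) (words ℓ) ++ map (D ∷_) (words ℓ)

height : ℤ → List Step → ℤ
height h [] = h
height h (U ∷ w) = height (h ℤ.+ + 1) w
height h (D ∷ w) = height (h ℤ.- + 1) w

-- Number of up steps under the x-axis (an up step from height -h to -h+1
-- with h ≥ 1), for a word started at height h.
underUps : ℤ → List Step → ℕ
underUps h [] = 0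
underUps (+ x) (U ∷ w) = underUps (+ x ℤ.+ + 1) w
underUps -[1+ x ] (U ∷ w) = suc (underUps (-[1+ x ] ℤ.+ + 1) w)
underUps h (D ∷ w) = underUps (h ℤ.- + 1) w

doubleDescents : List Step → ℕ
doubleDescents [] = 0
doubleDescents (D ∷ D ∷ w) = suc (doubleDescents (D ∷ w))
doubleDescents (_ ∷ w) = doubleDescents w

IsCounted : ℕ → ℕ → ℕ → List Step → Set
IsCounted n m k w =
  (length w ≡ n + n) × (height (+ 0) w ≡ + 0) × (underUps (+ 0) w ≡ m) × (doubleDescents w ≡ k)

d : ℕ → ℕ → ℕ → ℕ
d n m k = length (filter (λ w → dec w) (words (n + n)))
  where
  open import Relation.Nullary using (Dec)
  open import Relation.Nullary.Decidable using (_×-dec_)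
  import Data.Integer.Properties as ℤP
  import Data.List.Properties as LP
  dec : (w : List Step) → Dec (IsCounted n m k w)
  dec w = (length w ≟ n + n) ×-dec ((height (+ 0) w ℤP.≟ + 0) ×-dec ((underUps (+ 0) w ≟ m) ×-dec (doubleDescents w ≟ k)))

-- The map L U A D N ↦ A D N U L, which cuts a path at its last up step from height 0 (A staying
-- above and N below the axis) and moves L to the end, preserves length, final height and double
-- descents and adds one flaw; cutting at the first down step from height 0 inverts it. Hence
-- d n m k does not depend on m ≤ n (as in the Chung–Feller theorem), and (n + 1) · d n 0 k counts
-- all words with n up and n down steps and k double descents. Their down steps form n ∸ k runs, in
-- C(n − 1, k) ways, occupying n ∸ k of the n + 1 gaps between up steps; so the count is
-- C(n − 1, k) C(n + 1, k + 1), and (k + 1) C(n + 1, k + 1) = (n + 1) C(n, k).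

module Submission where

open import Defs
open import Level using (Level)
open import Data.Empty using (⊥-elim)
open import Data.Nat using (ℕ; zero; suc; _+_; _*_; _∸_; _≤_; _<_; z≤n; s≤s; _≟_; _≤?_; ⌊_/2⌋)
open import Data.Nat.Properties
open import Data.Nat.Combinatorics using (_C_; nCk+nC[k+1]≡[n+1]C[k+1]; nCk≡nC[n∸k])
open import Data.Nat.Tactic.RingSolver using (solve-∀)
open import Data.Integer as ℤ using (ℤ; +_; -[1+_]; 0ℤ; 1ℤ; -1ℤ)
import Data.Integer.Properties as ℤP
import Data.Integer.Tactic.RingSolver as ℤSolver
open import Data.List using (List; []; _∷_; [_]; _++_; length; map; filter; reverse; downFrom)
open import Data.List.Properties
  using (≡-dec; ∷-injectiveˡ; ∷-injectiveʳ; ++-assoc; length-++; reverse-++; unfold-reverse; reverse-involutive)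
open import Data.List.Relation.Unary.All as All using (All; []; _∷_)
open import Data.List.Relation.Unary.All.Properties using (++⁺; map⁺)
open import Data.Product using (Σ-syntax; _×_; _,_; proj₁; proj₂)
open import Function using (id; _∘_)
open import Relation.Nullary using (Dec; yes; no; ¬_)
open import Relation.Nullary.Decidable using (_×-dec_)
open import Relation.Unary using (Pred; Decidable)
open import Relation.Binary.Definitions using (DecidableEquality)
open import Relation.Binary.PropositionalEquality hiding ([_])

private
  variable
    a ℓ₁ ℓ₂ : Level
    X Y : Set a

∑ : List X → (X → ℕ) → ℕ
∑ [] F = 0
∑ (x ∷ xs) F = F x + ∑ xs F

infix 5 ∑
syntax ∑ xs (λ x → e) = ∑[ x ∈ xs ] e

𝟙 : Dec X → ℕ
𝟙 (yes _) = 1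
𝟙 (no _) = 0

𝟙-yes : X → (d : Dec X) → 𝟙 d ≡ 1
𝟙-yes x (yes _) = refl
𝟙-yes x (no ¬x) = ⊥-elim (¬x x)

𝟙-no : ¬ X → (d : Dec X) → 𝟙 d ≡ 0
𝟙-no ¬x (yes x) = ⊥-elim (¬x x)
𝟙-no ¬x (no _) = refl

𝟙-cong : (X → Y) → (Y → X) → (d : Dec X) (e : Dec Y) → 𝟙 d ≡ 𝟙 e
𝟙-cong f g (yes x) e = sym (𝟙-yes (f x) e)
𝟙-cong f g (no ¬x) e = sym (𝟙-no (λ y → ¬x (g y)) e)

length-filter≡∑𝟙 : {P : Pred X ℓ₁} (P? : Decidable P) (xs : List X) →
  length (filter P? xs) ≡ ∑[ x ∈ xs ] 𝟙 (P? x)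
length-filter≡∑𝟙 P? [] = refl
length-filter≡∑𝟙 P? (x ∷ xs) with P? x
... | yes _ = cong suc (length-filter≡∑𝟙 P? xs)
... | no _ = length-filter≡∑𝟙 P? xs

∑-cong : (xs : List X) {F G : X → ℕ} → (∀ x → F x ≡ G x) → ∑ xs F ≡ ∑ xs G
∑-cong [] eq = refl
∑-cong (x ∷ xs) eq = cong₂ _+_ (eq x) (∑-cong xs eq)

∑-cong-All : {P : Pred X ℓ₁} {xs : List X} {F G : X → ℕ} →
  All P xs → (∀ {x} → P x → F x ≡ G x) → ∑ xs F ≡ ∑ xs G
∑-cong-All [] eq = refl
∑-cong-All (px ∷ pxs) eq = cong₂ _+_ (eq px) (∑-cong-All pxs eq)

∑-zero : (xs : List X) {F : X → ℕ} → (∀ x → F x ≡ 0) → ∑ xs F ≡ 0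
∑-zero xs eq = trans (∑-cong xs eq) (∑-const0 xs)
  where
  ∑-const0 : (xs : List X) → ∑[ x ∈ xs ] 0 ≡ 0
  ∑-const0 [] = refl
  ∑-const0 (_ ∷ xs) = ∑-const0 xs

∑-++ : (xs ys : List X) (F : X → ℕ) → ∑ (xs ++ ys) F ≡ ∑ xs F + ∑ ys F
∑-++ [] ys F = refl
∑-++ (x ∷ xs) ys F = trans (cong (_+_ (F x)) (∑-++ xs ys F)) (sym (+-assoc (F x) _ _))

∑-map : (f : X → Y) (xs : List X) (F : Y → ℕ) → ∑ (map f xs) F ≡ ∑[ x ∈ xs ] F (f x)
∑-map f [] F = refl
∑-map f (x ∷ xs) F = cong (_+_ (F (f x))) (∑-map f xs F)

∑-+ : (xs : List X) (F G : X → ℕ) → ∑[ x ∈ xs ] (F x + G x) ≡ ∑ xs F + ∑ xs G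
∑-+ [] F G = refl
∑-+ (x ∷ xs) F G rewrite ∑-+ xs F G = +-exchange (F x) (G x) (∑ xs F) (∑ xs G)
  where
  +-exchange : ∀ a b c d → a + b + (c + d) ≡ a + c + (b + d)
  +-exchange = solve-∀

*-distribˡ-∑ : (c : ℕ) (xs : List X) (F : X → ℕ) → c * ∑ xs F ≡ ∑[ x ∈ xs ] c * F x
*-distribˡ-∑ c [] F = *-zeroʳ c
*-distribˡ-∑ c (x ∷ xs) F = trans (*-distribˡ-+ c (F x) _) (cong (_+_ (c * F x)) (*-distribˡ-∑ c xs F))

∑-comm : (xs : List X) (ys : List Y) (F : X → Y → ℕ) →
  ∑[ x ∈ xs ] ∑[ y ∈ ys ] F x y ≡ ∑[ y ∈ ys ] ∑[ x ∈ xs ] F x y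
∑-comm [] ys F = sym (∑-zero ys (λ _ → refl))
∑-comm (x ∷ xs) ys F =
  trans (cong (_+_ (∑ ys (F x))) (∑-comm xs ys F)) (sym (∑-+ ys (F x) (λ y → ∑[ x′ ∈ xs ] F x′ y)))

module _ (_≟ᴬ_ : DecidableEquality X) (xs : List X)
         {P : Pred X ℓ₁} {Q : Pred X ℓ₂} (P? : Decidable P) (Q? : Decidable Q)
         (f g : X → X)
         (P-once : ∀ {x} → P x → ∑[ y ∈ xs ] 𝟙 (y ≟ᴬ x) ≡ 1)
         (Q-once : ∀ {y} → Q y → ∑[ x ∈ xs ] 𝟙 (x ≟ᴬ y) ≡ 1)
         (f-Q : ∀ {x} → P x → Q (f x)) (g-P : ∀ {y} → Q y → P (g y))
         (g∘f : ∀ {x} → P x → g (f x) ≡ x) (f∘g : ∀ {y} → Q y → f (g y) ≡ y)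
         where

  ∑𝟙-bijection : ∑[ x ∈ xs ] 𝟙 (P? x) ≡ ∑[ y ∈ xs ] 𝟙 (Q? y)
  ∑𝟙-bijection = begin
    ∑[ x ∈ xs ] 𝟙 (P? x)                                ≡⟨ ∑-cong xs weight ⟩
    ∑[ x ∈ xs ] 𝟙 (P? x) * (∑[ y ∈ xs ] 𝟙 (y ≟ᴬ f x))  ≡⟨ ∑-cong xs (λ x → *-distribˡ-∑ (𝟙 (P? x)) xs _) ⟩
    ∑[ x ∈ xs ] ∑[ y ∈ xs ] 𝟙 (P? x) * 𝟙 (y ≟ᴬ f x)    ≡⟨ ∑-comm xs xs _ ⟩
    ∑[ y ∈ xs ] ∑[ x ∈ xs ] 𝟙 (P? x) * 𝟙 (y ≟ᴬ f x)    ≡⟨ ∑-cong xs fibre ⟩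
    ∑[ y ∈ xs ] 𝟙 (Q? y)                                ∎
    where
    open ≡-Reasoning

    weight : ∀ x → 𝟙 (P? x) ≡ 𝟙 (P? x) * (∑[ y ∈ xs ] 𝟙 (y ≟ᴬ f x))
    weight x with P? x
    ... | yes px = sym (trans (+-identityʳ _) (Q-once (f-Q px)))
    ... | no _ = refl

    fibre : ∀ y → ∑[ x ∈ xs ] 𝟙 (P? x) * 𝟙 (y ≟ᴬ f x) ≡ 𝟙 (Q? y)
    fibre y with Q? y
    ... | yes qy = trans (∑-cong xs onlyPreimage) (P-once (g-P qy))
      where
      onlyPreimage : ∀ x → 𝟙 (P? x) * 𝟙 (y ≟ᴬ f x) ≡ 𝟙 (x ≟ᴬ g y)
      onlyPreimage x with x ≟ᴬ g y
      ... | yes refl = cong₂ _*_ (𝟙-yes (g-P qy) (P? x)) (𝟙-yes (sym (f∘g qy)) (y ≟ᴬ f x))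
      ... | no x≢gy with P? x | y ≟ᴬ f x
      ...   | yes px | yes refl = ⊥-elim (x≢gy (sym (g∘f px)))
      ...   | yes _ | no _ = refl
      ...   | no _ | _ = refl
    ... | no ¬qy = ∑-zero xs noPreimage
      where
      noPreimage : ∀ x → 𝟙 (P? x) * 𝟙 (y ≟ᴬ f x) ≡ 0
      noPreimage x with P? x | y ≟ᴬ f x
      ... | yes px | yes refl = ⊥-elim (¬qy (f-Q px))
      ... | yes _ | no _ = refl
      ... | no _ | _ = refl

infix 4 _≟ˢ_ _≟ʷ_

_≟ˢ_ : DecidableEquality Step
U ≟ˢ U = yes refl
U ≟ˢ D = no λ ()
D ≟ˢ U = no λ ()
D ≟ˢ D = yes refl

_≟ʷ_ : DecidableEquality (List Step)
_≟ʷ_ = ≡-dec _≟ˢ_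

words-length : ∀ ℓ → All (λ w → length w ≡ ℓ) (words ℓ)
words-length zero = refl ∷ []
words-length (suc ℓ) = ++⁺ (map⁺ suc-lengths) (map⁺ suc-lengths)
  where
  suc-lengths : All (λ w → suc (length w) ≡ suc ℓ) (words ℓ)
  suc-lengths = All.map (cong suc) (words-length ℓ)

words-once : ∀ ℓ {w} → length w ≡ ℓ → ∑[ v ∈ words ℓ ] 𝟙 (v ≟ʷ w) ≡ 1
words-once zero {[]} refl = refl
words-once (suc ℓ) {x ∷ w} len = begin
  ∑ (map (U ∷_) (words ℓ) ++ map (D ∷_) (words ℓ)) (λ v → 𝟙 (v ≟ʷ x ∷ w))
    ≡⟨ ∑-++ (map (U ∷_) (words ℓ)) _ _ ⟩
  ∑ (map (U ∷_) (words ℓ)) (λ v → 𝟙 (v ≟ʷ x ∷ w))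
    + ∑ (map (D ∷_) (words ℓ)) (λ v → 𝟙 (v ≟ʷ x ∷ w))
    ≡⟨ cong₂ _+_ (∑-map (U ∷_) (words ℓ) _) (∑-map (D ∷_) (words ℓ) _) ⟩
  (∑[ v ∈ words ℓ ] 𝟙 (U ∷ v ≟ʷ x ∷ w)) + (∑[ v ∈ words ℓ ] 𝟙 (D ∷ v ≟ʷ x ∷ w))
    ≡⟨ halves x ⟩
  1 ∎
  where
  open ≡-Reasoning
  tail-once : ∀ y → ∑[ v ∈ words ℓ ] 𝟙 (y ∷ v ≟ʷ y ∷ w) ≡ 1
  tail-once y = trans (∑-cong (words ℓ) (λ v → 𝟙-cong ∷-injectiveʳ (cong (y ∷_)) _ _))
                      (words-once ℓ (suc-injective len))
  head-mismatch : ∀ {y z} → y ≢ z → ∑[ v ∈ words ℓ ] 𝟙 (y ∷ v ≟ʷ z ∷ w) ≡ 0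
  head-mismatch y≢z = ∑-zero (words ℓ) (λ v → 𝟙-no (λ eq → y≢z (∷-injectiveˡ eq)) _)
  halves : ∀ x → (∑[ v ∈ words ℓ ] 𝟙 (U ∷ v ≟ʷ x ∷ w))
                 + (∑[ v ∈ words ℓ ] 𝟙 (D ∷ v ≟ʷ x ∷ w)) ≡ 1
  halves U = cong₂ _+_ (tail-once U) (head-mismatch {D} {U} λ ())
  halves D = cong₂ _+_ (head-mismatch {U} {D} λ ()) (tail-once D)

ups downs : List Step → ℕ
ups [] = 0
ups (U ∷ w) = suc (ups w)
ups (D ∷ w) = ups w
downs [] = 0
downs (U ∷ w) = downs w
downs (D ∷ w) = suc (downs w)

ups-++ : ∀ v w → ups (v ++ w) ≡ ups v + ups w
ups-++ [] w = refl
ups-++ (U ∷ v) w = cong suc (ups-++ v w)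
ups-++ (D ∷ v) w = ups-++ v w

downs-++ : ∀ v w → downs (v ++ w) ≡ downs v + downs w
downs-++ [] w = refl
downs-++ (U ∷ v) w = downs-++ v w
downs-++ (D ∷ v) w = cong suc (downs-++ v w)

ups-reverse : ∀ w → ups (reverse w) ≡ ups w
ups-reverse [] = refl
ups-reverse (x ∷ w) rewrite unfold-reverse x w | ups-++ (reverse w) [ x ] | ups-reverse w = lemma x
  where
  lemma : ∀ x → ups w + ups [ x ] ≡ ups (x ∷ w)
  lemma U = +-comm (ups w) 1
  lemma D = +-identityʳ (ups w)

downs-reverse : ∀ w → downs (reverse w) ≡ downs w
downs-reverse [] = refl
downs-reverse (x ∷ w) rewrite unfold-reverse x w | downs-++ (reverse w) [ x ] | downs-reverse w = lemma x
  where
  lemma : ∀ x → downs w + downs [ x ] ≡ downs (x ∷ w)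
  lemma U = +-identityʳ (downs w)
  lemma D = +-comm (downs w) 1

length≡ups+downs : ∀ w → length w ≡ ups w + downs w
length≡ups+downs [] = refl
length≡ups+downs (U ∷ w) = cong suc (length≡ups+downs w)
length≡ups+downs (D ∷ w) = trans (cong suc (length≡ups+downs w)) (sym (+-suc (ups w) (downs w)))

-- Copies of height and underUps stepping by ℤ.suc/ℤ.pred, which (unlike h + 1 and h - 1)
-- compute on the constructors + n and -[1+ n ].

level : ℤ → List Step → ℤ
level h [] = h
level h (U ∷ w) = level (ℤ.suc h) w
level h (D ∷ w) = level (ℤ.pred h) w

flaws : ℤ → List Step → ℕ
flaws h [] = 0
flaws h (D ∷ w) = flaws (ℤ.pred h) w
flaws h@(+ _) (U ∷ w) = flaws (ℤ.suc h) w
flaws h@(-[1+ _ ]) (U ∷ w) = suc (flaws (ℤ.suc h) w)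

height≡level : ∀ h w → height h w ≡ level h w
height≡level h [] = refl
height≡level h (U ∷ w) rewrite ℤP.+-comm h 1ℤ = height≡level (ℤ.suc h) w
height≡level h (D ∷ w) rewrite ℤP.+-comm h -1ℤ = height≡level (ℤ.pred h) w

underUps≡flaws : ∀ h w → underUps h w ≡ flaws h w
underUps≡flaws h [] = refl
underUps≡flaws h@(+ _) (D ∷ w) rewrite ℤP.+-comm h -1ℤ = underUps≡flaws (ℤ.pred h) w
underUps≡flaws h@(-[1+ _ ]) (D ∷ w) rewrite ℤP.+-comm h -1ℤ = underUps≡flaws (ℤ.pred h) w
underUps≡flaws h@(+ _) (U ∷ w) rewrite ℤP.+-comm h 1ℤ = underUps≡flaws (ℤ.suc h) w
underUps≡flaws h@(-[1+ _ ]) (U ∷ w) rewrite ℤP.+-comm h 1ℤ = cong suc (underUps≡flaws (ℤ.suc h) w)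

level-++ : ∀ h v w → level h (v ++ w) ≡ level (level h v) w
level-++ h [] w = refl
level-++ h (U ∷ v) w = level-++ (ℤ.suc h) v w
level-++ h (D ∷ v) w = level-++ (ℤ.pred h) v w

flaws-++ : ∀ h v w → flaws h (v ++ w) ≡ flaws h v + flaws (level h v) w
flaws-++ h [] w = refl
flaws-++ h (D ∷ v) w = flaws-++ (ℤ.pred h) v w
flaws-++ h@(+ _) (U ∷ v) w = flaws-++ (ℤ.suc h) v w
flaws-++ h@(-[1+ _ ]) (U ∷ v) w = cong suc (flaws-++ (ℤ.suc h) v w)

level-closed : ∀ h w → level h w ≡ h ℤ.+ (+ ups w ℤ.- + downs w)
level-closed h [] = sym (ℤP.+-identityʳ h)
level-closed h (U ∷ w) = trans (level-closed (ℤ.suc h) w) (shift h (+ ups w) (+ downs w))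
  where
  shift : ∀ h u d → (1ℤ ℤ.+ h) ℤ.+ (u ℤ.- d) ≡ h ℤ.+ ((1ℤ ℤ.+ u) ℤ.- d)
  shift = ℤSolver.solve-∀
level-closed h (D ∷ w) = trans (level-closed (ℤ.pred h) w) (shift h (+ ups w) (+ downs w))
  where
  shift : ∀ h u d → (-1ℤ ℤ.+ h) ℤ.+ (u ℤ.- d) ≡ h ℤ.+ (u ℤ.- (1ℤ ℤ.+ d))
  shift = ℤSolver.solve-∀

level-balanced : ∀ h w → ups w ≡ downs w → level h w ≡ h
level-balanced h w eq = begin
  level h w                               ≡⟨ level-closed h w ⟩
  h ℤ.+ (+ ups w ℤ.- + downs w)           ≡⟨ cong (λ u → h ℤ.+ (+ u ℤ.- + downs w)) eq ⟩
  h ℤ.+ (+ downs w ℤ.- + downs w)         ≡⟨ cong (ℤ._+_ h) (ℤP.+-inverseʳ (+ downs w)) ⟩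
  h ℤ.+ 0ℤ                                ≡⟨ ℤP.+-identityʳ h ⟩
  h                                       ∎
  where open ≡-Reasoning

level0⇒balanced : ∀ w → level 0ℤ w ≡ 0ℤ → ups w ≡ downs w
level0⇒balanced w eq =
  ℤP.+-injective (ℤP.i-j≡0⇒i≡j (+ ups w) (+ downs w)
    (trans (sym (ℤP.+-identityˡ _)) (trans (sym (level-closed 0ℤ w)) eq)))

level-reverse : ∀ h w → level (ℤ.- level h w) (reverse w) ≡ ℤ.- h
level-reverse h w = begin
  level (ℤ.- level h w) (reverse w)
    ≡⟨ level-closed _ (reverse w) ⟩
  ℤ.- level h w ℤ.+ (+ ups (reverse w) ℤ.- + downs (reverse w))
    ≡⟨ cong₂ (λ l e → ℤ.- l ℤ.+ e) (level-closed h w)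
             (cong₂ (λ u d → + u ℤ.- + d) (ups-reverse w) (downs-reverse w)) ⟩
  ℤ.- (h ℤ.+ (+ ups w ℤ.- + downs w)) ℤ.+ (+ ups w ℤ.- + downs w)
    ≡⟨ cancel h (+ ups w ℤ.- + downs w) ⟩
  ℤ.- h ∎
  where
  open ≡-Reasoning
  cancel : ∀ h e → ℤ.- (h ℤ.+ e) ℤ.+ e ≡ ℤ.- h
  cancel = ℤSolver.solve-∀

flaws≤ups : ∀ h w → flaws h w ≤ ups w
flaws≤ups h [] = z≤n
flaws≤ups h (D ∷ w) = flaws≤ups (ℤ.pred h) w
flaws≤ups h@(+ _) (U ∷ w) = m≤n⇒m≤1+n (flaws≤ups (ℤ.suc h) w)
flaws≤ups h@(-[1+ _ ]) (U ∷ w) = s≤s (flaws≤ups (ℤ.suc h) w)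

-- Reading a path backwards turns the up steps at nonnegative height into flaws and vice versa.
flaws-reverse : ∀ h w → flaws h w + flaws (ℤ.- level h w) (reverse w) ≡ ups w
flaws-reverse h [] = refl
flaws-reverse h (x ∷ w) = begin
  flaws h (x ∷ w) + flaws (ℤ.- level h (x ∷ w)) (reverse (x ∷ w))
    ≡⟨ cong₂ _+_ (flaws-++ h [ x ] w) (cong₂ (λ l v → flaws (ℤ.- l) v) (level-++ h [ x ] w) (unfold-reverse x w)) ⟩
  flaws h [ x ] + flaws h′ w + flaws e (reverse w ++ [ x ])
    ≡⟨ cong (_+_ (flaws h [ x ] + flaws h′ w)) (flaws-++ e (reverse w) [ x ]) ⟩
  flaws h [ x ] + flaws h′ w + (flaws e (reverse w) + flaws (level e (reverse w)) [ x ])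
    ≡⟨ cong (λ l → flaws h [ x ] + flaws h′ w + (flaws e (reverse w) + flaws l [ x ])) (level-reverse h′ w) ⟩
  flaws h [ x ] + flaws h′ w + (flaws e (reverse w) + flaws (ℤ.- h′) [ x ])
    ≡⟨ regroup (flaws h [ x ]) (flaws h′ w) _ _ ⟩
  (flaws h [ x ] + flaws (ℤ.- h′) [ x ]) + (flaws h′ w + flaws e (reverse w))
    ≡⟨ cong₂ _+_ (one-step h x) (flaws-reverse h′ w) ⟩
  ups [ x ] + ups w
    ≡⟨ ups-++ [ x ] w ⟨
  ups (x ∷ w) ∎
  where
  open ≡-Reasoning
  h′ e : ℤ
  h′ = level h [ x ]
  e = ℤ.- level h′ w
  regroup : ∀ a b c d → a + b + (c + d) ≡ (a + d) + (b + c)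
  regroup = solve-∀
  one-step : ∀ h x → flaws h [ x ] + flaws (ℤ.- level h [ x ]) [ x ] ≡ ups [ x ]
  one-step h D = refl
  one-step (+ n) U = refl
  one-step -[1+ zero ] U = refl
  one-step -[1+ suc n ] U = refl

-- Walks confined to one side of the axis

data Walk⁺ : ℕ → ℕ → List Step → Set where
  stay : ∀ {a} → Walk⁺ a a []
  up   : ∀ {a b w} → Walk⁺ (suc a) b w → Walk⁺ a b (U ∷ w)
  down : ∀ {a b w} → Walk⁺ a b w → Walk⁺ (suc a) b (D ∷ w)

-- The indices of Walk⁻ are depths below the axis.
data Walk⁻ : ℕ → ℕ → List Step → Set where
  stay : ∀ {a} → Walk⁻ a a []
  down : ∀ {a b w} → Walk⁻ (suc a) b w → Walk⁻ a b (D ∷ w)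
  up   : ∀ {a b w} → Walk⁻ a b w → Walk⁻ (suc a) b (U ∷ w)

shift⁺ : ∀ {a b w} → Walk⁺ a b w → Walk⁺ (suc a) (suc b) w
shift⁺ stay = stay
shift⁺ (up p) = up (shift⁺ p)
shift⁺ (down p) = down (shift⁺ p)

shift⁻ : ∀ {a b w} → Walk⁻ a b w → Walk⁻ (suc a) (suc b) w
shift⁻ stay = stay
shift⁻ (down p) = down (shift⁻ p)
shift⁻ (up p) = up (shift⁻ p)

Walk⁺-level : ∀ {a b w} → Walk⁺ a b w → level (+ a) w ≡ + b
Walk⁺-level stay = refl
Walk⁺-level (up p) = Walk⁺-level p
Walk⁺-level (down p) = Walk⁺-level p

Walk⁻-level : ∀ {a b w} → Walk⁻ a b w → level (ℤ.- + a) w ≡ ℤ.- + b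
Walk⁻-level stay = refl
Walk⁻-level {zero} (down p) = Walk⁻-level p
Walk⁻-level {suc _} (down p) = Walk⁻-level p
Walk⁻-level {suc zero} (up p) = Walk⁻-level p
Walk⁻-level {suc (suc _)} (up p) = Walk⁻-level p

Walk⁺-balanced : ∀ {w} → Walk⁺ 0 0 w → ups w ≡ downs w
Walk⁺-balanced {w} p = level0⇒balanced w (Walk⁺-level p)

Walk⁻-balanced : ∀ {w} → Walk⁻ 0 0 w → ups w ≡ downs w
Walk⁻-balanced {w} p = level0⇒balanced w (Walk⁻-level p)

Walk⁺-flaws : ∀ {a b w} → Walk⁺ a b w → flaws (+ a) w ≡ 0
Walk⁺-flaws stay = refl
Walk⁺-flaws (up p) = Walk⁺-flaws p
Walk⁺-flaws (down p) = Walk⁺-flaws p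

Walk⁻-flaws : ∀ {a b w} → Walk⁻ a b w → flaws (ℤ.- + a) w ≡ ups w
Walk⁻-flaws stay = refl
Walk⁻-flaws {zero} (down p) = Walk⁻-flaws p
Walk⁻-flaws {suc _} (down p) = Walk⁻-flaws p
Walk⁻-flaws {suc zero} (up p) = cong suc (Walk⁻-flaws p)
Walk⁻-flaws {suc (suc _)} (up p) = cong suc (Walk⁻-flaws p)

Walk⁺-∷ʳU : ∀ {a b w} → Walk⁺ a b w → Walk⁺ a (suc b) (w ++ [ U ])
Walk⁺-∷ʳU stay = up stay
Walk⁺-∷ʳU (up p) = up (Walk⁺-∷ʳU p)
Walk⁺-∷ʳU (down p) = down (Walk⁺-∷ʳU p)

Walk⁺-∷ʳD : ∀ {a b w} → Walk⁺ a (suc b) w → Walk⁺ a b (w ++ [ D ])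
Walk⁺-∷ʳD stay = down stay
Walk⁺-∷ʳD (up p) = up (Walk⁺-∷ʳD p)
Walk⁺-∷ʳD (down p) = down (Walk⁺-∷ʳD p)

Walk⁻-∷ʳU : ∀ {a b w} → Walk⁻ a (suc b) w → Walk⁻ a b (w ++ [ U ])
Walk⁻-∷ʳU stay = up stay
Walk⁻-∷ʳU (down p) = down (Walk⁻-∷ʳU p)
Walk⁻-∷ʳU (up p) = up (Walk⁻-∷ʳU p)

Walk⁻-∷ʳD : ∀ {a b w} → Walk⁻ a b w → Walk⁻ a (suc b) (w ++ [ D ])
Walk⁻-∷ʳD stay = down stay
Walk⁻-∷ʳD (down p) = down (Walk⁻-∷ʳD p)
Walk⁻-∷ʳD (up p) = up (Walk⁻-∷ʳD p)

Walk⁺-reverse : ∀ {a b w} → Walk⁺ a b w → Walk⁻ b a (reverse w)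
Walk⁺-reverse stay = stay
Walk⁺-reverse (up {w = w} p) = subst (Walk⁻ _ _) (sym (unfold-reverse U w)) (Walk⁻-∷ʳU (Walk⁺-reverse p))
Walk⁺-reverse (down {w = w} p) = subst (Walk⁻ _ _) (sym (unfold-reverse D w)) (Walk⁻-∷ʳD (Walk⁺-reverse p))

Walk⁻-reverse : ∀ {a b w} → Walk⁻ a b w → Walk⁺ b a (reverse w)
Walk⁻-reverse stay = stay
Walk⁻-reverse (down {w = w} p) = subst (Walk⁺ _ _) (sym (unfold-reverse D w)) (Walk⁺-∷ʳD (Walk⁻-reverse p))
Walk⁻-reverse (up {w = w} p) = subst (Walk⁺ _ _) (sym (unfold-reverse U w)) (Walk⁺-∷ʳU (Walk⁻-reverse p))

-- The D after a nonnegative walk down to 0 is the first step below the axis, hence unique.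
Walk⁺-split-unique : ∀ {a x x′ y y′} → Walk⁺ a 0 x → Walk⁺ a 0 x′ →
  x ++ D ∷ y ≡ x′ ++ D ∷ y′ → x ≡ x′ × y ≡ y′
Walk⁺-split-unique stay stay eq = refl , ∷-injectiveʳ eq
Walk⁺-split-unique stay (up _) ()
Walk⁺-split-unique (up _) stay ()
Walk⁺-split-unique (up _) (down _) ()
Walk⁺-split-unique (down _) (up _) ()
Walk⁺-split-unique (up p) (up p′) eq with Walk⁺-split-unique p p′ (∷-injectiveʳ eq)
... | refl , eq′ = refl , eq′
Walk⁺-split-unique (down p) (down p′) eq with Walk⁺-split-unique p p′ (∷-injectiveʳ eq)
... | refl , eq′ = refl , eq′

Walk⁻-split-unique : ∀ {a x x′ y y′} → Walk⁻ a 0 x → Walk⁻ a 0 x′ →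
  x ++ U ∷ y ≡ x′ ++ U ∷ y′ → x ≡ x′ × y ≡ y′
Walk⁻-split-unique stay stay eq = refl , ∷-injectiveʳ eq
Walk⁻-split-unique stay (down _) ()
Walk⁻-split-unique (down _) stay ()
Walk⁻-split-unique (up _) (down _) ()
Walk⁻-split-unique (down _) (up _) ()
Walk⁻-split-unique (down p) (down p′) eq with Walk⁻-split-unique p p′ (∷-injectiveʳ eq)
... | refl , eq′ = refl , eq′
Walk⁻-split-unique (up p) (up p′) eq with Walk⁻-split-unique p p′ (∷-injectiveʳ eq)
... | refl , eq′ = refl , eq′

-- Ascent and descent factorisations

-- For valid pieces (A a nonnegative, N a nonpositive excursion) of a path ending at height 0,
-- the U of L U A D N is its last up step from 0 and the D of A D N U L its first down step from 0.
record Pieces : Set where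
  constructor pieces
  field
    L A N : List Step

ascentForm descentForm : Pieces → List Step
ascentForm (pieces L A N) = L ++ U ∷ A ++ D ∷ N
descentForm (pieces L A N) = A ++ D ∷ N ++ U ∷ L

Valid : Pieces → Set
Valid (pieces L A N) = Walk⁺ 0 0 A × Walk⁻ 0 0 N

mirror : Pieces → Pieces
mirror (pieces L A N) = pieces (reverse L) (reverse N) (reverse A)

mirror-involutive : ∀ s → mirror (mirror s) ≡ s
mirror-involutive (pieces L A N)
  rewrite reverse-involutive L | reverse-involutive A | reverse-involutive N = refl

mirror-injective : ∀ {s t} → mirror s ≡ mirror t → s ≡ t
mirror-injective {s} {t} eq = trans (sym (mirror-involutive s)) (trans (cong mirror eq) (mirror-involutive t))

mirror-Valid : ∀ {s} → Valid s → Valid (mirror s)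
mirror-Valid (p , q) = Walk⁻-reverse q , Walk⁺-reverse p

reverse-ascentForm : ∀ s → reverse (ascentForm s) ≡ descentForm (mirror s)
reverse-ascentForm (pieces L A N) = begin
  reverse (L ++ U ∷ A ++ D ∷ N)                         ≡⟨ reverse-++ L (U ∷ A ++ D ∷ N) ⟩
  reverse (U ∷ A ++ D ∷ N) ++ reverse L                 ≡⟨ cong (_++ reverse L) (unfold-reverse U (A ++ D ∷ N)) ⟩
  (reverse (A ++ D ∷ N) ++ [ U ]) ++ reverse L          ≡⟨ ++-assoc (reverse (A ++ D ∷ N)) [ U ] (reverse L) ⟩
  reverse (A ++ D ∷ N) ++ U ∷ reverse L                 ≡⟨ cong (_++ U ∷ reverse L) (reverse-++ A (D ∷ N)) ⟩
  (reverse (D ∷ N) ++ reverse A) ++ U ∷ reverse L       ≡⟨ ++-assoc (reverse (D ∷ N)) (reverse A) (U ∷ reverse L) ⟩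
  reverse (D ∷ N) ++ reverse A ++ U ∷ reverse L         ≡⟨ cong (_++ reverse A ++ U ∷ reverse L) (unfold-reverse D N) ⟩
  (reverse N ++ [ D ]) ++ reverse A ++ U ∷ reverse L    ≡⟨ ++-assoc (reverse N) [ D ] (reverse A ++ U ∷ reverse L) ⟩
  reverse N ++ D ∷ reverse A ++ U ∷ reverse L           ∎
  where open ≡-Reasoning

reverse-descentForm : ∀ s → reverse (descentForm s) ≡ ascentForm (mirror s)
reverse-descentForm s = begin
  reverse (descentForm s)                     ≡⟨ cong (reverse ∘ descentForm) (sym (mirror-involutive s)) ⟩
  reverse (descentForm (mirror (mirror s)))   ≡⟨ cong reverse (reverse-ascentForm (mirror s)) ⟨
  reverse (reverse (ascentForm (mirror s)))   ≡⟨ reverse-involutive _ ⟩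
  ascentForm (mirror s)                       ∎
  where open ≡-Reasoning

descentForm-injective : ∀ {s t} → Valid s → Valid t → descentForm s ≡ descentForm t → s ≡ t
descentForm-injective {pieces L A N} {pieces L′ A′ N′} (p , q) (p′ , q′) eq
  with Walk⁺-split-unique p p′ eq
... | refl , eq′ with Walk⁻-split-unique q q′ eq′
...   | refl , refl = refl

ascentForm-injective : ∀ {s t} → Valid s → Valid t → ascentForm s ≡ ascentForm t → s ≡ t
ascentForm-injective {s} {t} vs vt eq = mirror-injective (descentForm-injective (mirror-Valid {s} vs) (mirror-Valid {t} vt)
  (trans (sym (reverse-ascentForm s)) (trans (cong reverse eq) (reverse-ascentForm t))))

firstReturn : ∀ d w → level -[1+ d ] w ≡ 0ℤ →
  Σ[ N ∈ List Step ] Σ[ L ∈ List Step ] w ≡ N ++ U ∷ L × Walk⁻ d 0 N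
firstReturn d [] ()
firstReturn zero (U ∷ w) _ = [] , w , refl , stay
firstReturn (suc d) (U ∷ w) eq with firstReturn d w eq
... | N , L , refl , q = U ∷ N , L , refl , up q
firstReturn d (D ∷ w) eq with firstReturn (suc d) w eq
... | N , L , refl , q = D ∷ N , L , refl , down q

firstDescent : ∀ a w → level (+ a) w ≡ 0ℤ → 0 < flaws (+ a) w →
  Σ[ A ∈ List Step ] Σ[ N ∈ List Step ] Σ[ L ∈ List Step ]
    w ≡ A ++ D ∷ N ++ U ∷ L × Walk⁺ a 0 A × Walk⁻ 0 0 N
firstDescent a (U ∷ w) eq flawed with firstDescent (suc a) w eq flawed
... | A , N , L , refl , p , q = U ∷ A , N , L , refl , up p , q
firstDescent zero (D ∷ w) eq _ with firstReturn 0 w eq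
... | N , L , refl , q = [] , N , L , refl , stay , q
firstDescent (suc a) (D ∷ w) eq flawed with firstDescent a w eq flawed
... | A , N , L , refl , p , q = D ∷ A , N , L , refl , down p , q

descentPieces : ∀ w → level 0ℤ w ≡ 0ℤ → 0 < flaws 0ℤ w → Σ[ s ∈ Pieces ] Valid s × w ≡ descentForm s
descentPieces w eq flawed with firstDescent 0 w eq flawed
... | A , N , L , w≡ , p , q = pieces L A N , (p , q) , w≡

-- The ascent form of w is read off the descent form of its reverse.
ascentPieces : ∀ w → level 0ℤ w ≡ 0ℤ → flaws 0ℤ w < ups w → Σ[ s ∈ Pieces ] Valid s × w ≡ ascentForm s
ascentPieces w balanced unflawed =
  let s , v , rw≡ = descentPieces (reverse w) reverse-balanced reverse-flawed
  in mirror s , mirror-Valid {s} v , (begin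
    w                              ≡⟨ reverse-involutive w ⟨
    reverse (reverse w)            ≡⟨ cong reverse rw≡ ⟩
    reverse (descentForm s)        ≡⟨ reverse-descentForm s ⟩
    ascentForm (mirror s)          ∎)
  where
  open ≡-Reasoning
  reverse-balanced : level 0ℤ (reverse w) ≡ 0ℤ
  reverse-balanced = subst (λ l → level (ℤ.- l) (reverse w) ≡ 0ℤ) balanced (level-reverse 0ℤ w)
  total : flaws 0ℤ w + flaws 0ℤ (reverse w) ≡ ups w
  total = subst (λ l → flaws 0ℤ w + flaws (ℤ.- l) (reverse w) ≡ ups w) balanced (flaws-reverse 0ℤ w)
  reverse-flawed : 0 < flaws 0ℤ (reverse w)
  reverse-flawed = n≢0⇒n>0 λ none → <⇒≢ unflawed
    (trans (sym (+-identityʳ _)) (trans (cong (_+_ (flaws 0ℤ w)) (sym none)) total))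

length-forms : ∀ s → length (ascentForm s) ≡ length (descentForm s)
length-forms (pieces L A N)
  rewrite length-++ L {U ∷ A ++ D ∷ N} | length-++ A {D ∷ N} | length-++ A {D ∷ N ++ U ∷ L} | length-++ N {U ∷ L}
  = rearrange (length L) (length A) (length N)
  where
  rearrange : ∀ l a n → l + suc (a + suc n) ≡ a + suc (n + suc l)
  rearrange = solve-∀

level-ascentForm : ∀ {s} → Valid s → ∀ h → level h (ascentForm s) ≡ level h (Pieces.L s)
level-ascentForm {pieces L A N} (p , q) h = begin
  level h (L ++ U ∷ A ++ D ∷ N)         ≡⟨ level-++ h L (U ∷ A ++ D ∷ N) ⟩
  level l (U ∷ A ++ D ∷ N)              ≡⟨ level-++ (ℤ.suc l) A (D ∷ N) ⟩
  level (level (ℤ.suc l) A) (D ∷ N)     ≡⟨ cong (λ x → level x (D ∷ N)) (level-balanced _ A (Walk⁺-balanced p)) ⟩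
  level (ℤ.pred (ℤ.suc l)) N            ≡⟨ level-balanced _ N (Walk⁻-balanced q) ⟩
  ℤ.pred (ℤ.suc l)                      ≡⟨ ℤP.pred-suc l ⟩
  l                                     ∎
  where
  open ≡-Reasoning
  l : ℤ
  l = level h L

level-descentForm : ∀ {s} → Valid s → ∀ h → level h (descentForm s) ≡ level h (Pieces.L s)
level-descentForm {pieces L A N} (p , q) h = begin
  level h (A ++ D ∷ N ++ U ∷ L)         ≡⟨ level-++ h A (D ∷ N ++ U ∷ L) ⟩
  level (level h A) (D ∷ N ++ U ∷ L)    ≡⟨ cong (λ x → level x (D ∷ N ++ U ∷ L)) (level-balanced h A (Walk⁺-balanced p)) ⟩
  level (ℤ.pred h) (N ++ U ∷ L)         ≡⟨ level-++ (ℤ.pred h) N (U ∷ L) ⟩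
  level (level (ℤ.pred h) N) (U ∷ L)    ≡⟨ cong (λ x → level x (U ∷ L)) (level-balanced _ N (Walk⁻-balanced q)) ⟩
  level (ℤ.suc (ℤ.pred h)) L            ≡⟨ cong (λ x → level x L) (ℤP.suc-pred h) ⟩
  level h L                             ∎
  where open ≡-Reasoning

height-forms : ∀ {s} → Valid s → ∀ h → height h (ascentForm s) ≡ height h (descentForm s)
height-forms {s} v h = begin
  height h (ascentForm s)   ≡⟨ height≡level h (ascentForm s) ⟩
  level h (ascentForm s)    ≡⟨ level-ascentForm {s} v h ⟩
  level h (Pieces.L s)      ≡⟨ level-descentForm {s} v h ⟨
  level h (descentForm s)   ≡⟨ height≡level h (descentForm s) ⟨
  height h (descentForm s)  ∎
  where open ≡-Reasoning

flaws-ascentForm : ∀ {s} → Valid s → level 0ℤ (Pieces.L s) ≡ 0ℤ →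
  flaws 0ℤ (ascentForm s) ≡ flaws 0ℤ (Pieces.L s) + ups (Pieces.N s)
flaws-ascentForm {pieces L A N} (p , q) balancedL = begin
  flaws 0ℤ (L ++ U ∷ A ++ D ∷ N)                          ≡⟨ flaws-++ 0ℤ L (U ∷ A ++ D ∷ N) ⟩
  flaws 0ℤ L + flaws (level 0ℤ L) (U ∷ A ++ D ∷ N)        ≡⟨ cong (λ l → flaws 0ℤ L + flaws l (U ∷ A ++ D ∷ N)) balancedL ⟩
  flaws 0ℤ L + flaws 1ℤ (A ++ D ∷ N)                      ≡⟨ cong (_+_ (flaws 0ℤ L)) (flaws-++ 1ℤ A (D ∷ N)) ⟩
  flaws 0ℤ L + (flaws 1ℤ A + flaws (level 1ℤ A) (D ∷ N))  ≡⟨ cong₂ (λ f l → flaws 0ℤ L + (f + flaws l (D ∷ N)))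
                                                                    (Walk⁺-flaws (shift⁺ p)) (level-balanced 1ℤ A (Walk⁺-balanced p)) ⟩
  flaws 0ℤ L + flaws 0ℤ N                                 ≡⟨ cong (_+_ (flaws 0ℤ L)) (Walk⁻-flaws q) ⟩
  flaws 0ℤ L + ups N                                      ∎
  where open ≡-Reasoning

flaws-descentForm : ∀ {s} → Valid s → flaws 0ℤ (descentForm s) ≡ suc (flaws 0ℤ (Pieces.L s) + ups (Pieces.N s))
flaws-descentForm {pieces L A N} (p , q) = begin
  flaws 0ℤ (A ++ D ∷ N ++ U ∷ L)                          ≡⟨ flaws-++ 0ℤ A (D ∷ N ++ U ∷ L) ⟩
  flaws 0ℤ A + flaws (level 0ℤ A) (D ∷ N ++ U ∷ L)        ≡⟨ cong₂ (λ f l → f + flaws l (D ∷ N ++ U ∷ L))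
                                                                    (Walk⁺-flaws p) (level-balanced 0ℤ A (Walk⁺-balanced p)) ⟩
  flaws -1ℤ (N ++ U ∷ L)                                  ≡⟨ flaws-++ -1ℤ N (U ∷ L) ⟩
  flaws -1ℤ N + flaws (level -1ℤ N) (U ∷ L)               ≡⟨ cong₂ (λ f l → f + flaws l (U ∷ L))
                                                                    (Walk⁻-flaws (shift⁻ q)) (level-balanced -1ℤ N (Walk⁻-balanced q)) ⟩
  ups N + suc (flaws 0ℤ L)                                ≡⟨ +-suc (ups N) (flaws 0ℤ L) ⟩
  suc (ups N + flaws 0ℤ L)                                ≡⟨ cong suc (+-comm (ups N) (flaws 0ℤ L)) ⟩
  suc (flaws 0ℤ L + ups N)                                ∎
  where open ≡-Reasoning

underUps-forms : ∀ {s} → Valid s → height 0ℤ (ascentForm s) ≡ 0ℤ →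
  underUps 0ℤ (descentForm s) ≡ suc (underUps 0ℤ (ascentForm s))
underUps-forms {s} v balanced = begin
  underUps 0ℤ (descentForm s)                  ≡⟨ underUps≡flaws 0ℤ (descentForm s) ⟩
  flaws 0ℤ (descentForm s)                     ≡⟨ flaws-descentForm {s} v ⟩
  suc (flaws 0ℤ (Pieces.L s) + ups (Pieces.N s)) ≡⟨ cong suc (flaws-ascentForm {s} v balancedL) ⟨
  suc (flaws 0ℤ (ascentForm s))                ≡⟨ cong suc (underUps≡flaws 0ℤ (ascentForm s)) ⟨
  suc (underUps 0ℤ (ascentForm s))             ∎
  where
  open ≡-Reasoning
  balancedL : level 0ℤ (Pieces.L s) ≡ 0ℤ
  balancedL = trans (sym (level-ascentForm {s} v 0ℤ)) (trans (sym (height≡level 0ℤ (ascentForm s))) balanced)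

doubleDescents-++ : ∀ v y w → doubleDescents (v ++ y ∷ w) ≡ doubleDescents (v ++ [ y ]) + doubleDescents (y ∷ w)
doubleDescents-++ [] U w = refl
doubleDescents-++ [] D w = refl
doubleDescents-++ (U ∷ v) y w = doubleDescents-++ v y w
doubleDescents-++ (D ∷ []) U w = refl
doubleDescents-++ (D ∷ []) D w = refl
doubleDescents-++ (D ∷ U ∷ v) y w = doubleDescents-++ (U ∷ v) y w
doubleDescents-++ (D ∷ D ∷ v) y w = cong suc (doubleDescents-++ (D ∷ v) y w)

doubleDescents-∷ʳU : ∀ v → doubleDescents (v ++ [ U ]) ≡ doubleDescents v
doubleDescents-∷ʳU [] = refl
doubleDescents-∷ʳU (U ∷ v) = doubleDescents-∷ʳU v
doubleDescents-∷ʳU (D ∷ []) = refl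
doubleDescents-∷ʳU (D ∷ U ∷ v) = doubleDescents-∷ʳU (U ∷ v)
doubleDescents-∷ʳU (D ∷ D ∷ v) = cong suc (doubleDescents-∷ʳU (D ∷ v))

doubleDescents-forms : ∀ s → doubleDescents (ascentForm s) ≡ doubleDescents (descentForm s)
doubleDescents-forms (pieces L A N) = begin
  DD (L ++ U ∷ A ++ D ∷ N)                        ≡⟨ doubleDescents-++ L U (A ++ D ∷ N) ⟩
  DD (L ++ [ U ]) + DD (A ++ D ∷ N)               ≡⟨ cong₂ _+_ (doubleDescents-∷ʳU L) (doubleDescents-++ A D N) ⟩
  DD L + (DD (A ++ [ D ]) + DD (D ∷ N))           ≡⟨ rotate (DD L) (DD (A ++ [ D ])) (DD (D ∷ N)) ⟩
  DD (A ++ [ D ]) + (DD (D ∷ N) + DD L)           ≡⟨ cong (λ x → DD (A ++ [ D ]) + (x + DD L)) (doubleDescents-∷ʳU (D ∷ N)) ⟨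
  DD (A ++ [ D ]) + (DD (D ∷ N ++ [ U ]) + DD L)  ≡⟨ cong (_+_ (DD (A ++ [ D ]))) (doubleDescents-++ (D ∷ N) U L) ⟨
  DD (A ++ [ D ]) + DD (D ∷ N ++ U ∷ L)           ≡⟨ doubleDescents-++ A D (N ++ U ∷ L) ⟨
  DD (A ++ D ∷ N ++ U ∷ L)                        ∎
  where
  open ≡-Reasoning
  DD : List Step → ℕ
  DD = doubleDescents
  rotate : ∀ l a n → l + (a + n) ≡ a + (n + l)
  rotate = solve-∀

ascent→descent : ∀ {n m k s} → Valid s → IsCounted n m k (ascentForm s) → IsCounted n (suc m) k (descentForm s)
ascent→descent {s = s} v (len , balanced , flawed , dd) =
  trans (sym (length-forms s)) len ,
  trans (sym (height-forms {s} v 0ℤ)) balanced ,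
  trans (underUps-forms {s} v balanced) (cong suc flawed) ,
  trans (sym (doubleDescents-forms s)) dd

descent→ascent : ∀ {n m k s} → Valid s → IsCounted n (suc m) k (descentForm s) → IsCounted n m k (ascentForm s)
descent→ascent {s = s} v (len , balanced , flawed , dd) =
  trans (length-forms s) len ,
  balanced′ ,
  suc-injective (trans (sym (underUps-forms {s} v balanced′)) flawed) ,
  trans (doubleDescents-forms s) dd
  where
  balanced′ : height 0ℤ (ascentForm s) ≡ 0ℤ
  balanced′ = trans (height-forms {s} v 0ℤ) balanced

-- Independence of the number of flaws

isCounted? : ∀ n m k → Decidable (IsCounted n m k)
isCounted? n m k w =
  (length w ≟ n + n) ×-dec ((height 0ℤ w ℤP.≟ 0ℤ) ×-dec ((underUps 0ℤ w ≟ m) ×-dec (doubleDescents w ≟ k)))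

d≡∑ : ∀ n m k → d n m k ≡ ∑[ w ∈ words (n + n) ] 𝟙 (isCounted? n m k w)
d≡∑ n m k = trans (length-filter≡∑𝟙 _ (words (n + n))) (∑-cong (words (n + n)) (λ w → 𝟙-cong id id _ _))

+-self-injective : ∀ {a b} → a + a ≡ b + b → a ≡ b
+-self-injective {a} {b} eq = trans (n≡⌊n+n/2⌋ a) (trans (cong ⌊_/2⌋ eq) (sym (n≡⌊n+n/2⌋ b)))

module _ (n : ℕ) {m k : ℕ} (w : List Step) (c : IsCounted n m k w) where

  counted-level : level 0ℤ w ≡ 0ℤ
  counted-level = trans (sym (height≡level 0ℤ w)) (proj₁ (proj₂ c))

  counted-flaws : flaws 0ℤ w ≡ m
  counted-flaws = trans (sym (underUps≡flaws 0ℤ w)) (proj₁ (proj₂ (proj₂ c)))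

  counted-downs : downs w ≡ n
  counted-downs = +-self-injective (begin
    downs w + downs w  ≡⟨ cong (_+ downs w) (level0⇒balanced w counted-level) ⟨
    ups w + downs w    ≡⟨ length≡ups+downs w ⟨
    length w           ≡⟨ proj₁ c ⟩
    n + n              ∎)
    where open ≡-Reasoning

  counted-ups : ups w ≡ n
  counted-ups = trans (level0⇒balanced w counted-level) counted-downs

module FlawShift {n m k : ℕ} (m<n : m < n) where

  private
    unflawed : ∀ w → IsCounted n m k w → flaws 0ℤ w < ups w
    unflawed w c = subst₂ _<_ (sym (counted-flaws n w c)) (sym (counted-ups n w c)) m<n

    flawed : ∀ w → IsCounted n (suc m) k w → 0 < flaws 0ℤ w
    flawed w c = subst (0 <_) (sym (counted-flaws n w c)) (s≤s z≤n)

  addFlaw : List Step → List Step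
  addFlaw w with isCounted? n m k w
  ... | yes c = descentForm (proj₁ (ascentPieces w (counted-level n w c) (unflawed w c)))
  ... | no _ = w

  removeFlaw : List Step → List Step
  removeFlaw w with isCounted? n (suc m) k w
  ... | yes c = ascentForm (proj₁ (descentPieces w (counted-level n w c) (flawed w c)))
  ... | no _ = w

  addFlaw-ascentForm : ∀ {s} → Valid s → IsCounted n m k (ascentForm s) → addFlaw (ascentForm s) ≡ descentForm s
  addFlaw-ascentForm {s} v c with isCounted? n m k (ascentForm s)
  ... | no ¬c = ⊥-elim (¬c c)
  ... | yes c′ =
    let t , vt , s≡t = ascentPieces (ascentForm s) (counted-level n (ascentForm s) c′) (unflawed (ascentForm s) c′)
    in cong descentForm (ascentForm-injective {t} {s} vt v (sym s≡t))

  removeFlaw-descentForm : ∀ {s} → Valid s → IsCounted n (suc m) k (descentForm s) → removeFlaw (descentForm s) ≡ ascentForm s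
  removeFlaw-descentForm {s} v c with isCounted? n (suc m) k (descentForm s)
  ... | no ¬c = ⊥-elim (¬c c)
  ... | yes c′ =
    let t , vt , s≡t = descentPieces (descentForm s) (counted-level n (descentForm s) c′) (flawed (descentForm s) c′)
    in cong ascentForm (descentForm-injective {t} {s} vt v (sym s≡t))

  onAscentForm : (R : List Step → Set) →
    (∀ {s} → Valid s → IsCounted n m k (ascentForm s) → R (ascentForm s)) →
    ∀ {w} → IsCounted n m k w → R w
  onAscentForm R onForm {w} c =
    let s , v , w≡ = ascentPieces w (counted-level n w c) (unflawed w c)
    in subst R (sym w≡) (onForm {s} v (subst (IsCounted n m k) w≡ c))

  onDescentForm : (R : List Step → Set) →
    (∀ {s} → Valid s → IsCounted n (suc m) k (descentForm s) → R (descentForm s)) →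
    ∀ {w} → IsCounted n (suc m) k w → R w
  onDescentForm R onForm {w} c =
    let s , v , w≡ = descentPieces w (counted-level n w c) (flawed w c)
    in subst R (sym w≡) (onForm {s} v (subst (IsCounted n (suc m) k) w≡ c))

  addFlaw-counted : ∀ {w} → IsCounted n m k w → IsCounted n (suc m) k (addFlaw w)
  addFlaw-counted {w} = onAscentForm (λ w → IsCounted n (suc m) k (addFlaw w)) (λ {s} v c →
    subst (IsCounted n (suc m) k) (sym (addFlaw-ascentForm {s} v c)) (ascent→descent {n = n} {s = s} v c)) {w}

  removeFlaw-counted : ∀ {w} → IsCounted n (suc m) k w → IsCounted n m k (removeFlaw w)
  removeFlaw-counted {w} = onDescentForm (λ w → IsCounted n m k (removeFlaw w)) (λ {s} v c →
    subst (IsCounted n m k) (sym (removeFlaw-descentForm {s} v c)) (descent→ascent {n = n} {s = s} v c)) {w}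

  removeFlaw∘addFlaw : ∀ {w} → IsCounted n m k w → removeFlaw (addFlaw w) ≡ w
  removeFlaw∘addFlaw {w} = onAscentForm (λ w → removeFlaw (addFlaw w) ≡ w) (λ {s} v c →
    trans (cong removeFlaw (addFlaw-ascentForm {s} v c)) (removeFlaw-descentForm {s} v (ascent→descent {n = n} {s = s} v c))) {w}

  addFlaw∘removeFlaw : ∀ {w} → IsCounted n (suc m) k w → addFlaw (removeFlaw w) ≡ w
  addFlaw∘removeFlaw {w} = onDescentForm (λ w → addFlaw (removeFlaw w) ≡ w) (λ {s} v c →
    trans (cong addFlaw (removeFlaw-descentForm {s} v c)) (addFlaw-ascentForm {s} v (descent→ascent {n = n} {s = s} v c))) {w}

  d-suc : d n m k ≡ d n (suc m) k
  d-suc = begin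
    d n m k                                               ≡⟨ d≡∑ n m k ⟩
    ∑[ w ∈ words (n + n) ] 𝟙 (isCounted? n m k w)         ≡⟨ bijection ⟩
    ∑[ w ∈ words (n + n) ] 𝟙 (isCounted? n (suc m) k w)   ≡⟨ d≡∑ n (suc m) k ⟨
    d n (suc m) k                                         ∎
    where
    open ≡-Reasoning
    counted-once : ∀ {m w} → IsCounted n m k w → ∑[ v ∈ words (n + n) ] 𝟙 (v ≟ʷ w) ≡ 1
    counted-once {w = w} c = words-once (n + n) {w} (proj₁ c)
    bijection : ∑[ w ∈ words (n + n) ] 𝟙 (isCounted? n m k w) ≡ ∑[ w ∈ words (n + n) ] 𝟙 (isCounted? n (suc m) k w)
    bijection = ∑𝟙-bijection _≟ʷ_ (words (n + n)) (isCounted? n m k) (isCounted? n (suc m) k) addFlaw removeFlaw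
      counted-once counted-once (λ {w} → addFlaw-counted {w}) (λ {w} → removeFlaw-counted {w})
      removeFlaw∘addFlaw addFlaw∘removeFlaw

d-flaw-independent : ∀ {n m k} → m ≤ n → d n m k ≡ d n 0 k
d-flaw-independent {m = zero} _ = refl
d-flaw-independent {m = suc m} m<n = trans (sym (FlawShift.d-suc m<n)) (d-flaw-independent (<⇒≤ m<n))

-- Counting all paths by double descents

∑-downFrom-const : ∀ N (F : ℕ → ℕ) c → (∀ m → m < N → F m ≡ c) → ∑[ m ∈ downFrom N ] F m ≡ N * c
∑-downFrom-const zero F c eq = refl
∑-downFrom-const (suc N) F c eq = cong₂ _+_ (eq N ≤-refl) (∑-downFrom-const N F c (λ m m<N → eq m (m≤n⇒m≤1+n m<N)))

∑-downFrom-none : ∀ {x} N → N ≤ x → ∑[ m ∈ downFrom N ] 𝟙 (x ≟ m) ≡ 0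
∑-downFrom-none zero _ = refl
∑-downFrom-none {x} (suc N) N<x =
  cong₂ _+_ (𝟙-no (λ x≡N → <-irrefl (sym x≡N) N<x) (x ≟ N)) (∑-downFrom-none N (<⇒≤ N<x))

∑-downFrom-once : ∀ {x} N → x < N → ∑[ m ∈ downFrom N ] 𝟙 (x ≟ m) ≡ 1
∑-downFrom-once {x} (suc N) x<1+N with x ≟ N
... | yes refl = cong suc (∑-downFrom-none N ≤-refl)
... | no x≢N = ∑-downFrom-once N (≤∧≢⇒< (≤-pred x<1+N) x≢N)

-- A path of semilength n has at most n flaws, so it is counted by exactly one d n m k with m ≤ n.
∑-flaw-counts : ∀ n k {w} → length w ≡ n + n →
  ∑[ m ∈ downFrom (suc n) ] 𝟙 (isCounted? n m k w) ≡ 𝟙 (downs w ≟ n) * 𝟙 (doubleDescents w ≟ k)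
∑-flaw-counts n k {w} len with downs w ≟ n | doubleDescents w ≟ k
... | yes downs≡n | yes dd =
  trans (∑-cong (downFrom (suc n)) (λ m → 𝟙-cong (λ c → proj₁ (proj₂ (proj₂ c))) (λ u → len , balanced , u , dd) _ _))
        (∑-downFrom-once (suc n) (s≤s underUps≤n))
  where
  ups≡n : ups w ≡ n
  ups≡n = +-cancelʳ-≡ n (ups w) n (trans (cong (_+_ (ups w)) (sym downs≡n)) (trans (sym (length≡ups+downs w)) len))
  balanced : height 0ℤ w ≡ 0ℤ
  balanced = trans (height≡level 0ℤ w) (level-balanced 0ℤ w (trans ups≡n (sym downs≡n)))
  underUps≤n : underUps 0ℤ w ≤ n
  underUps≤n = subst₂ _≤_ (sym (underUps≡flaws 0ℤ w)) ups≡n (flaws≤ups 0ℤ w)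
... | yes _ | no ¬dd = ∑-zero (downFrom (suc n)) (λ m → 𝟙-no (λ c → ¬dd (proj₂ (proj₂ (proj₂ c)))) _)
... | no ¬downs | _ = ∑-zero (downFrom (suc n)) (λ m → 𝟙-no (λ c → ¬downs (counted-downs n w c)) _)

prefixCount : Step → ℕ → ℕ → ℕ → ℕ
prefixCount x ℓ j k = ∑[ w ∈ words ℓ ] 𝟙 (downs w ≟ j) * 𝟙 (doubleDescents (x ∷ w) ≟ k)

∑-flaws : ∀ n k → ∑[ m ∈ downFrom (suc n) ] d n m k ≡ prefixCount U (n + n) n k
∑-flaws n k = begin
  ∑[ m ∈ downFrom (suc n) ] d n m k
    ≡⟨ ∑-cong (downFrom (suc n)) (λ m → d≡∑ n m k) ⟩
  ∑[ m ∈ downFrom (suc n) ] ∑[ w ∈ words (n + n) ] 𝟙 (isCounted? n m k w)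
    ≡⟨ ∑-comm (downFrom (suc n)) (words (n + n)) _ ⟩
  ∑[ w ∈ words (n + n) ] ∑[ m ∈ downFrom (suc n) ] 𝟙 (isCounted? n m k w)
    ≡⟨ ∑-cong-All (words-length (n + n)) (λ {w} → ∑-flaw-counts n k {w}) ⟩
  prefixCount U (n + n) n k ∎
  where open ≡-Reasoning

prefixCount-suc : ∀ x ℓ j k → prefixCount x (suc ℓ) j k ≡
  prefixCount U ℓ j k + (∑[ w ∈ words ℓ ] 𝟙 (suc (downs w) ≟ j) * 𝟙 (doubleDescents (x ∷ D ∷ w) ≟ k))
prefixCount-suc U ℓ j k =
  trans (∑-++ (map (U ∷_) (words ℓ)) _ _) (cong₂ _+_ (∑-map (U ∷_) (words ℓ) _) (∑-map (D ∷_) (words ℓ) _))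
prefixCount-suc D ℓ j k =
  trans (∑-++ (map (U ∷_) (words ℓ)) _ _) (cong₂ _+_ (∑-map (U ∷_) (words ℓ) _) (∑-map (D ∷_) (words ℓ) _))

𝟙-suc≟suc : ∀ a b → 𝟙 (suc a ≟ suc b) ≡ 𝟙 (a ≟ b)
𝟙-suc≟suc a b = 𝟙-cong suc-injective (cong suc) _ _

prefixCount-zero : ∀ x ℓ k → prefixCount x (suc ℓ) 0 k ≡ prefixCount U ℓ 0 k
prefixCount-zero x ℓ k = trans (prefixCount-suc x ℓ 0 k)
  (trans (cong (_+_ (prefixCount U ℓ 0 k)) (∑-zero (words ℓ) (λ w → refl))) (+-identityʳ _))

prefixCountU-suc : ∀ ℓ j k → prefixCount U (suc ℓ) (suc j) k ≡ prefixCount U ℓ (suc j) k + prefixCount D ℓ j k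
prefixCountU-suc ℓ j k = trans (prefixCount-suc U ℓ (suc j) k) (cong (_+_ (prefixCount U ℓ (suc j) k))
  (∑-cong (words ℓ) (λ w → cong (_* 𝟙 (doubleDescents (D ∷ w) ≟ k)) (𝟙-suc≟suc (downs w) j))))

prefixCountD-suc-zero : ∀ ℓ j → prefixCount D (suc ℓ) (suc j) 0 ≡ prefixCount U ℓ (suc j) 0
prefixCountD-suc-zero ℓ j = trans (prefixCount-suc D ℓ (suc j) 0) (trans (cong (_+_ (prefixCount U ℓ (suc j) 0))
  (∑-zero (words ℓ) (λ w → *-zeroʳ (𝟙 (suc (downs w) ≟ suc j))))) (+-identityʳ _))

prefixCountD-suc-suc : ∀ ℓ j k →
  prefixCount D (suc ℓ) (suc j) (suc k) ≡ prefixCount U ℓ (suc j) (suc k) + prefixCount D ℓ j k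
prefixCountD-suc-suc ℓ j k = trans (prefixCount-suc D ℓ (suc j) (suc k)) (cong (_+_ (prefixCount U ℓ (suc j) (suc k)))
  (∑-cong (words ℓ) (λ w → cong₂ _*_ (𝟙-suc≟suc (downs w) j) (𝟙-suc≟suc (doubleDescents (D ∷ w)) k))))

prefixCount-overfull : ∀ x ℓ j k → ℓ < j → prefixCount x ℓ j k ≡ 0
prefixCount-overfull x ℓ j k ℓ<j =
  trans (∑-cong-All {G = λ _ → 0} (words-length ℓ) (λ {w} len → cong (_* 𝟙 (doubleDescents (x ∷ w) ≟ k)) (none w len)))
        (∑-zero (words ℓ) (λ _ → refl))
  where
  downs≤length : ∀ w → length w ≡ ℓ → downs w ≤ ℓ
  downs≤length w len = subst (downs w ≤_) (trans (sym (length≡ups+downs w)) len) (m≤n+m (downs w) (ups w))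
  none : ∀ w → length w ≡ ℓ → 𝟙 (downs w ≟ j) ≡ 0
  none w len = 𝟙-no (λ downs≡j → <-irrefl downs≡j (≤-<-trans (downs≤length w len) ℓ<j)) (downs w ≟ j)

binom : ℕ → ℕ → ℕ
binom n zero = 1
binom zero (suc k) = 0
binom (suc n) (suc k) = binom n k + binom n (suc k)

binom≡C : ∀ n k → binom n k ≡ n C k
binom≡C n zero = refl
binom≡C zero (suc k) = refl
binom≡C (suc n) (suc k) = trans (cong₂ _+_ (binom≡C n k) (binom≡C n (suc k))) (nCk+nC[k+1]≡[n+1]C[k+1] n k)

binom-symmetric : ∀ {n k} → k ≤ n → binom n (n ∸ k) ≡ binom n k
binom-symmetric {n} {k} k≤n = trans (binom≡C n (n ∸ k)) (trans (sym (nCk≡nC[n∸k] k≤n)) (sym (binom≡C n k)))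

binom-overfull : ∀ {n k} → n < k → binom n k ≡ 0
binom-overfull {zero} {suc k} _ = refl
binom-overfull {suc n} {suc k} (s≤s n<k) = cong₂ _+_ (binom-overfull n<k) (binom-overfull (m≤n⇒m≤1+n n<k))

binom-1 : ∀ n → binom n 1 ≡ n
binom-1 zero = refl
binom-1 (suc n) = cong suc (binom-1 n)

binom-absorb : ∀ n k → suc k * binom (suc n) (suc k) ≡ suc n * binom n k
binom-absorb zero zero = refl
binom-absorb zero (suc k) = *-zeroʳ (suc (suc k))
binom-absorb (suc n) zero rewrite binom-1 n = trans (+-identityʳ _) (sym (*-identityʳ _))
binom-absorb (suc n) (suc k) = begin
  suc (suc k) * (x + y)               ≡⟨ expand k x y ⟩
  x + suc k * x + suc (suc k) * y     ≡⟨ cong₂ (λ u v → x + u + v) (binom-absorb n k) (binom-absorb n (suc k)) ⟩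
  x + suc n * p + suc n * q           ≡⟨ collect x (suc n) p q ⟩
  suc (suc n) * x                     ∎
  where
  open ≡-Reasoning
  x y p q : ℕ
  x = binom (suc n) (suc k)
  y = binom (suc n) (suc (suc k))
  p = binom n k
  q = binom n (suc k)
  expand : ∀ k x y → suc (suc k) * (x + y) ≡ x + suc k * x + suc (suc k) * y
  expand = solve-∀
  collect : ∀ x N p q → x + N * p + N * q ≡ x + N * (p + q)
  collect = solve-∀

-- Pascal's rule for the second factor; the truncated subtraction is harmless because for
-- k > b the first factor vanishes.
binom-pascal-∸ : ∀ a b k →
  binom b k * binom (suc a) (suc b ∸ k) ≡ binom b k * binom a (suc b ∸ k) + binom b k * binom a (b ∸ k)
binom-pascal-∸ a b k with k ≤? b
... | no k≰b rewrite binom-overfull {b} {k} (≰⇒> k≰b) = refl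
... | yes k≤b rewrite +-∸-assoc 1 {b} {k} k≤b =
  trans (*-distribˡ-+ (binom b k) (binom a (b ∸ k)) (binom a (suc (b ∸ k)))) (+-comm (binom b k * binom a (b ∸ k)) _)

binom-vanish : ∀ b k → binom b (suc k) * binom 0 (b ∸ k) ≡ 0
binom-vanish b k with b ≤? k
... | yes b≤k rewrite binom-overfull {b} {suc k} (s≤s b≤k) = refl
... | no b≰k rewrite +-∸-assoc 1 {b} {suc k} (≰⇒> b≰k) = *-zeroʳ (binom b (suc k))

-- Closed forms for a up and b down steps after the first letter: the down steps (with a leading
-- D) form runs, in binom b k ways, which occupy distinct gaps between the up steps.

closedU : ℕ → ℕ → ℕ → ℕ
closedU a zero k = binom 0 k
closedU a (suc b) k = binom b k * binom (suc a) (suc b ∸ k)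

closedD : ℕ → ℕ → ℕ → ℕ
closedD a b k = binom b k * binom a (b ∸ k)

mutual
  prefixCountU-closed : ∀ a b k → prefixCount U (a + b) b k ≡ closedU a b k
  prefixCountU-closed zero zero zero = refl
  prefixCountU-closed zero zero (suc k) = refl
  prefixCountU-closed (suc a) zero k = trans (prefixCount-zero U (a + 0) k) (prefixCountU-closed a zero k)
  prefixCountU-closed zero (suc b) k = begin
    prefixCount U (suc b) (suc b) k                           ≡⟨ prefixCountU-suc b b k ⟩
    prefixCount U b (suc b) k + prefixCount D b b k
      ≡⟨ cong₂ _+_ (prefixCount-overfull U b (suc b) k ≤-refl) (prefixCountD-closed zero b k) ⟩
    binom b k * binom 0 (b ∸ k)                               ≡⟨ cong (_+ binom b k * binom 0 (b ∸ k)) (vanish k) ⟨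
    binom b k * binom 0 (suc b ∸ k) + binom b k * binom 0 (b ∸ k) ≡⟨ binom-pascal-∸ 0 b k ⟨
    closedU zero (suc b) k                                    ∎
    where
    open ≡-Reasoning
    vanish : ∀ k → binom b k * binom 0 (suc b ∸ k) ≡ 0
    vanish zero = *-zeroʳ (binom b 0)
    vanish (suc k) = binom-vanish b k
  prefixCountU-closed (suc a) (suc b) k = begin
    prefixCount U (suc a + suc b) (suc b) k                     ≡⟨ prefixCountU-suc (a + suc b) b k ⟩
    prefixCount U (a + suc b) (suc b) k + prefixCount D (a + suc b) b k
      ≡⟨ cong₂ _+_ (prefixCountU-closed a (suc b) k) (prefixCountD-+-suc a b k) ⟩
    closedU a (suc b) k + closedD (suc a) b k                   ≡⟨ binom-pascal-∸ (suc a) b k ⟨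
    closedU (suc a) (suc b) k                                   ∎
    where open ≡-Reasoning

  prefixCountD-closed : ∀ a b k → prefixCount D (a + b) b k ≡ closedD a b k
  prefixCountD-closed zero zero zero = refl
  prefixCountD-closed zero zero (suc k) = refl
  prefixCountD-closed (suc a) zero zero = trans (prefixCount-zero D (a + 0) 0) (prefixCountU-closed a zero 0)
  prefixCountD-closed (suc a) zero (suc k) =
    trans (prefixCount-zero D (a + 0) (suc k)) (prefixCountU-closed a zero (suc k))
  prefixCountD-closed zero (suc b) zero = trans (prefixCountD-suc-zero b b) (prefixCount-overfull U b (suc b) 0 ≤-refl)
  prefixCountD-closed zero (suc b) (suc k) = begin
    prefixCount D (suc b) (suc b) (suc k)                       ≡⟨ prefixCountD-suc-suc b b k ⟩
    prefixCount U b (suc b) (suc k) + prefixCount D b b k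
      ≡⟨ cong₂ _+_ (prefixCount-overfull U b (suc b) (suc k) ≤-refl) (prefixCountD-closed zero b k) ⟩
    binom b k * binom 0 (b ∸ k)
      ≡⟨ +-identityʳ _ ⟨
    binom b k * binom 0 (b ∸ k) + 0
      ≡⟨ cong (_+_ (binom b k * binom 0 (b ∸ k))) (binom-vanish b k) ⟨
    binom b k * binom 0 (b ∸ k) + binom b (suc k) * binom 0 (b ∸ k)
      ≡⟨ *-distribʳ-+ (binom 0 (b ∸ k)) (binom b k) (binom b (suc k)) ⟨
    closedD zero (suc b) (suc k) ∎
    where open ≡-Reasoning
  prefixCountD-closed (suc a) (suc b) zero =
    trans (prefixCountD-suc-zero (a + suc b) b) (prefixCountU-closed a (suc b) zero)
  prefixCountD-closed (suc a) (suc b) (suc k) = begin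
    prefixCount D (suc a + suc b) (suc b) (suc k)               ≡⟨ prefixCountD-suc-suc (a + suc b) b k ⟩
    prefixCount U (a + suc b) (suc b) (suc k) + prefixCount D (a + suc b) b k
      ≡⟨ cong₂ _+_ (prefixCountU-closed a (suc b) (suc k)) (prefixCountD-+-suc a b k) ⟩
    binom b (suc k) * binom (suc a) (b ∸ k) + binom b k * binom (suc a) (b ∸ k)
      ≡⟨ +-comm (binom b (suc k) * binom (suc a) (b ∸ k)) _ ⟩
    binom b k * binom (suc a) (b ∸ k) + binom b (suc k) * binom (suc a) (b ∸ k)
      ≡⟨ *-distribʳ-+ (binom (suc a) (b ∸ k)) (binom b k) (binom b (suc k)) ⟨
    closedD (suc a) (suc b) (suc k)                             ∎
    where open ≡-Reasoning

  prefixCountD-+-suc : ∀ a b k → prefixCount D (a + suc b) b k ≡ closedD (suc a) b k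
  prefixCountD-+-suc a b k = trans (cong (λ ℓ → prefixCount D ℓ b k) (+-suc a b)) (prefixCountD-closed (suc a) b k)

suc*d≡closedU : ∀ n k → suc n * d n 0 k ≡ closedU n n k
suc*d≡closedU n k = begin
  suc n * d n 0 k
    ≡⟨ ∑-downFrom-const (suc n) (λ m → d n m k) (d n 0 k) (λ m m<1+n → d-flaw-independent (≤-pred m<1+n)) ⟨
  ∑[ m ∈ downFrom (suc n) ] d n m k      ≡⟨ ∑-flaws n k ⟩
  prefixCount U (n + n) n k              ≡⟨ prefixCountU-closed n n k ⟩
  closedU n n k                          ∎
  where open ≡-Reasoning

corollary4p4 : (n k m : ℕ) → k < n → m ≤ n →
  suc k * d n m k ≡ ((n ∸ 1) C k) * (n C k)
corollary4p4 zero k m () m≤n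
corollary4p4 (suc n) k m k<n m≤n = *-cancelˡ-≡ _ _ (suc (suc n)) (begin
  suc (suc n) * (suc k * d (suc n) m k)              ≡⟨ cong (λ x → suc (suc n) * (suc k * x)) (d-flaw-independent m≤n) ⟩
  suc (suc n) * (suc k * d (suc n) 0 k)              ≡⟨ x*[y*z]≡y*[x*z] (suc (suc n)) (suc k) (d (suc n) 0 k) ⟩
  suc k * (suc (suc n) * d (suc n) 0 k)              ≡⟨ cong (suc k *_) (suc*d≡closedU (suc n) k) ⟩
  suc k * (binom n k * binom (suc (suc n)) (suc n ∸ k)) ≡⟨ cong (λ x → suc k * (binom n k * x)) (binom-symmetric k<n+2) ⟩
  suc k * (binom n k * binom (suc (suc n)) (suc k))  ≡⟨ x*[y*z]≡y*[x*z] (suc k) (binom n k) _ ⟩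
  binom n k * (suc k * binom (suc (suc n)) (suc k))  ≡⟨ cong (binom n k *_) (binom-absorb (suc n) k) ⟩
  binom n k * (suc (suc n) * binom (suc n) k)        ≡⟨ x*[y*z]≡y*[x*z] (binom n k) (suc (suc n)) _ ⟩
  suc (suc n) * (binom n k * binom (suc n) k)        ≡⟨ cong₂ (λ x y → suc (suc n) * (x * y)) (binom≡C n k) (binom≡C (suc n) k) ⟩
  suc (suc n) * ((n C k) * (suc n C k))              ∎)
  where
  open ≡-Reasoning
  k<n+2 : suc k ≤ suc (suc n)
  k<n+2 = m≤n⇒m≤1+n k<n
  x*[y*z]≡y*[x*z] : ∀ x y z → x * (y * z) ≡ y * (x * z)
  x*[y*z]≡y*[x*z] = solve-∀
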